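{- Let $\varphi:\mathfrak{n}=\bigoplus_{i=0}^k\mathfrak{n}^i\to\mathfrak{m}=\bigoplus_{i=0}^l\mathfrak{m}^i$ be an isomorphism between Hoffman graphs $\mathfrak{n}$ and $\mathfrak{m}$, where $\mathfrak{n}^0,\dots,\mathfrak{n}^k$ are indecomposable addends of $\mathfrak{n}$ and $\mathfrak{m}^0,\dots,\mathfrak{m}^l$ are indecomposable addends of $\mathfrak{m}$. Then $k=l$ and there is a permutation $\sigma$ of $\{0,\dots,k\}$ such that $\varphi|_{V(\mathfrak{n}^i)}$ is an isomorphism $\mathfrak{n}^i\to\mathfrak{m}^{\sigma(i)}$ for every $i$.
   Context: A Hoffman graph $\mathfrak{h}=(H,\mu)$ is a finite simple graph $H$ with a labeling $\mu:V(H)\to\{f,s\}$ such that every fat vertex (label $f$) is adjacent to at least one slim vertex (label $s$), and fat vertices are pairwise non-adjacent. $V_s,V_f$ denote slim/fat vertex sets, $N^f_{\mathfrak{h}}(x)$ the fat neighbours of $x$. A Hoffman subgraph is an induced subgraph with restricted labeling. Isomorphisms are label-preserving graph isomorphisms. Sum: for Hoffman subgraphs $\mathfrak{h}^1,\dots,\mathfrak{h}^k$ of $\mathfrak{h}$, $\mathfrak{h}=\bigoplus_i\mathfrak{h}^i$ means (i) $V(\mathfrak{h})=\bigcup_iV(\mathfrak{h}^i)$; (ii) $V_s(\mathfrak{h})$ is the disjoint union of the $V_s(\mathfrak{h}^i)$; (iii) $N^f_{\mathfrak{h}^i}(x)=N^f_{\mathfrak{h}}(x)$ for $x\in V_s(\mathfrak{h}^i)$;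 (iv) for $x\in V_s(\mathfrak{h}^i)$, $y\in V_s(\mathfrak{h}^j)$, $i\ne j$: $|N^f_{\mathfrak{h}}(x)\cap N^f_{\mathfrak{h}}(y)|\le1$ with equality iff $x,y$ adjacent. $\mathfrak{h}$ is decomposable if it is the sum of two non-empty Hoffman subgraphs, otherwise indecomposable. An addend of $\mathfrak{h}$ is a non-empty Hoffman subgraph $\mathfrak{h}^1$ with $\mathfrak{h}=\mathfrak{h}^1\oplus\mathfrak{h}^2$ for some Hoffman subgraph $\mathfrak{h}^2$. -}

module Defs where

open import Data.Nat using (ℕ; zero; suc; _+_; _≤_)
open import Data.Fin using (Fin; zero; suc)
open import Data.Bool using (Bool; true; false; _∧_; if_then_else_)
open import Data.Product using (Σ; ∃; ∃-syntax; _×_; _,_)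
open import Relation.Binary.PropositionalEquality using (_≡_; _≢_)
open import Relation.Nullary using (¬_)
open import Function.Bundles using (Inverse; _↔_; _⇔_)

data Label : Set where
  fat slim : Label

isFat : Label → Bool
isFat fat = true
isFat slim = false

record HoffmanGraph : Set where
  field
    size         : ℕ
    adj          : Fin size → Fin size → Bool
    label        : Fin size → Label
    adj-sym      : ∀ x y → adj x y ≡ adj y x
    adj-irrefl   : ∀ x → adj x x ≡ false
    fat-indep    : ∀ x y → label x ≡ fat → label y ≡ fat → adj x y ≡ false
    fat-has-slim : ∀ x → label x ≡ fat → ∃[ y ] (label y ≡ slim × adj x y ≡ true)

open HoffmanGraph public

count : ∀ {n} → (Fin n → Bool) → ℕ
count {zero}  p = 0
count {suc n} p = (if p zero then 1 else 0) + count (λ i → p (suc i))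

-- vertex subsets of G; a Hoffman subgraph is identified with its vertex set
-- (induced subgraph, restricted labelling)
VSet : HoffmanGraph → Set
VSet G = Fin (size G) → Bool

_∈_ : ∀ {G} → Fin (size G) → VSet G → Set
x ∈ S = S x ≡ true

_⊆_ : ∀ {G} → VSet G → VSet G → Set
_⊆_ {G} S T = ∀ (x : Fin (size G)) → _∈_ {G} x S → _∈_ {G} x T

full : ∀ G → VSet G
full G x = true

Nonempty : ∀ G → VSet G → Set
Nonempty G S = ∃[ x ] _∈_ {G} x S

IsHoffmanSubgraph : ∀ G → VSet G → Set
IsHoffmanSubgraph G S =
  ∀ x → _∈_ {G} x S → label G x ≡ fat →
    ∃[ y ] (_∈_ {G} y S × label G y ≡ slim × adj G x y ≡ true)

commonFat : ∀ G → VSet G → Fin (size G) → Fin (size G) → ℕ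
commonFat G U x y = count (λ z → U z ∧ isFat (label G z) ∧ adj G x z ∧ adj G y z)

IsSum : ∀ G (U : VSet G) (k : ℕ) → (Fin k → VSet G) → Set
IsSum G U k F =
  (∀ i → IsHoffmanSubgraph G (F i) × _⊆_ {G} (F i) U)
  × (∀ x → _∈_ {G} x U → ∃[ i ] _∈_ {G} x (F i))
  -- (ii) slim vertex sets are disjoint (their union is V_s(U) by (i))
  × (∀ x i j → label G x ≡ slim → _∈_ {G} x (F i) → _∈_ {G} x (F j) → i ≡ j)
  -- (iii) N^f_{F i}(x) = N^f_U(x) for slim x in F i
  × (∀ i x z → _∈_ {G} x (F i) → label G x ≡ slim →
       _∈_ {G} z U → label G z ≡ fat → adj G x z ≡ true → _∈_ {G} z (F i))
  × (∀ i j x y → i ≢ j →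
       _∈_ {G} x (F i) → label G x ≡ slim → _∈_ {G} y (F j) → label G y ≡ slim →
       (commonFat G U x y ≤ 1) × (commonFat G U x y ≡ 1 ⇔ adj G x y ≡ true))

pair : ∀ {A : Set} → A → A → Fin 2 → A
pair a b zero = a
pair a b (suc _) = b

Decomposable : ∀ G → VSet G → Set
Decomposable G U =
  ∃[ A ] ∃[ B ] (Nonempty G A × Nonempty G B × IsSum G U 2 (pair A B))

Indecomposable : ∀ G → VSet G → Set
Indecomposable G U = ¬ Decomposable G U

IsAddend : ∀ G → VSet G → Set
IsAddend G S =
  Nonempty G S × IsHoffmanSubgraph G S × ∃[ T ] IsSum G (full G) 2 (pair S T)

record HoffmanIso (G H : HoffmanGraph) : Set where
  field
    bij       : Fin (size G) ↔ Fin (size H)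
    pres-adj  : ∀ x y → adj H (Inverse.to bij x) (Inverse.to bij y) ≡ adj G x y
    pres-label : ∀ x → label H (Inverse.to bij x) ≡ label G x

open HoffmanIso public

-- φ restricted to V(S) is an isomorphism of the Hoffman subgraphs S → T:
-- φ maps V(S) onto V(T) (adjacency and labels are preserved since φ is an isomorphism)
RestrictsToIso : ∀ {G H} → HoffmanIso G H → VSet G → VSet H → Set
RestrictsToIso {G} {H} φ S T =
  (∀ x → _∈_ {G} x S → _∈_ {H} (Inverse.to (bij φ) x) T)
  × (∀ y → _∈_ {H} y T → ∃[ x ] (_∈_ {G} x S × Inverse.to (bij φ) x ≡ y))

module Submission where

open import Defs
open import Data.Nat using (ℕ; suc; _+_; _≤_)
open import Data.Nat.Properties using (suc-injective; +-0-commutativeMonoid)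
open import Data.Fin using (Fin; zero; suc)
import Data.Fin as Fin
open import Data.Fin.Properties using (any?)
open import Data.Fin.Permutation using (Permutation; _⟨$⟩ʳ_; ↔⇒≡)
open import Data.Bool using (Bool; true; false; _∧_; if_then_else_)
import Data.Bool as Bool
open import Data.Product using (Σ; ∃; ∃-syntax; _×_; _,_; proj₁; proj₂)
open import Data.Sum using (_⊎_; inj₁; inj₂)
open import Data.Empty using (⊥-elim)
open import Relation.Nullary using (Dec; yes; no; does; _×-dec_; _⊎-dec_)
open import Relation.Nullary.Decidable using (dec-true)
open import Relation.Binary.PropositionalEquality
  using (_≡_; _≢_; refl; sym; trans; cong; cong₂; subst)
open import Function.Bundles using (Inverse; _⇔_; mk↔ₛ′; mk⇔; Equivalence)
open import Function.Construct.Symmetry using (↔-sym)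
open import Algebra.Properties.CommutativeMonoid.Sum +-0-commutativeMonoid
  using (sum; sum-permute)

-- Let φ : 𝔫 → 𝔪 be an isomorphism, 𝔫 = ⊕ 𝔫ⁱ and 𝔪 = ⊕ 𝔪ʲ with
-- all addends non-empty and indecomposable.
--  * Splitting: for a Hoffman subgraph U and a boolean predicate Q, the
--    vertices of U "anchored" at a slim vertex of U satisfying Q, resp. ¬Q,
--    form two Hoffman subgraphs whose sum is U, provided slim vertices on
--    different sides satisfy the sum condition (iv).
--  * Refinement: pulling back Q = 𝔪ʲ along φ, slim vertices of 𝔫ⁱ on different
--    sides lie in different addends of 𝔪, so (iv) for 𝔪 (transported by φ,
--    which preserves common fat neighbourhoods) gives the separation; by
--    indecomposability one side is empty, i.e. φ(𝔫ⁱ) ⊆ 𝔪ʲ for some j.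
--  * Matching: refinement in both directions gives f and g with
--    φ(𝔫ⁱ) ⊆ 𝔪^{f i} and φ⁻¹(𝔪ʲ) ⊆ 𝔫^{g j}; since distinct addends cannot be
--    nested (they have disjoint slim vertex sets), f and g are mutually
--    inverse, giving the permutation σ = f (and k = l).

∧-true⁻ : ∀ {a b} → a ∧ b ≡ true → a ≡ true × b ≡ true
∧-true⁻ {true} {true} _ = refl , refl

∧-absorbˡ : ∀ a b → (b ≡ true → a ≡ true) → a ∧ b ≡ b
∧-absorbˡ true  b     _ = refl
∧-absorbˡ false false _ = refl
∧-absorbˡ false true  h with h refl
... | ()

witness : ∀ {A : Set} (d : Dec A) → does d ≡ true → A
witness (yes a) _ = a

count-cong : ∀ {n} (p q : Fin n → Bool) → (∀ x → p x ≡ q x) → count p ≡ count q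
count-cong {ℕ.zero} p q h = refl
count-cong {suc n}  p q h =
  cong₂ _+_ (cong (λ b → if b then 1 else 0) (h zero))
        (count-cong (λ i → p (suc i)) (λ i → q (suc i)) (λ i → h (suc i)))

count-sum : ∀ {n} (p : Fin n → Bool) → count p ≡ sum (λ i → if p i then 1 else 0)
count-sum {ℕ.zero} p = refl
count-sum {suc n}  p = cong ((if p zero then 1 else 0) +_) (count-sum (λ i → p (suc i)))

count-permute : ∀ {m n} (p : Fin n → Bool) (π : Permutation m n) →
                count p ≡ count (λ x → p (π ⟨$⟩ʳ x))
count-permute p π = trans (count-sum p)
  (trans (sum-permute _ π) (sym (count-sum (λ x → p (π ⟨$⟩ʳ x)))))

_≟ᴸ_ : (a b : Label) → Dec (a ≡ b)
fat  ≟ᴸ fat  = yes refl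
fat  ≟ᴸ slim = no λ ()
slim ≟ᴸ fat  = no λ ()
slim ≟ᴸ slim = yes refl

SumCondition : ∀ G → VSet G → Fin (size G) → Fin (size G) → Set
SumCondition G U x y = (commonFat G U x y ≤ 1) × (commonFat G U x y ≡ 1 ⇔ adj G x y ≡ true)

SumCondition-transfer : ∀ {G H U V x y x′ y′} →
  commonFat G U x y ≡ commonFat H V x′ y′ → adj G x y ≡ adj H x′ y′ →
  SumCondition H V x′ y′ → SumCondition G U x y
SumCondition-transfer c a (bound , iff) =
  subst (_≤ 1) (sym c) bound ,
  mk⇔ (λ e → trans a (Equivalence.to iff (trans (sym c) e)))
      (λ e → trans c (Equivalence.from iff (trans (sym a) e)))

slim-member : ∀ {G S} → IsHoffmanSubgraph G S → Nonempty G S →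
              ∃[ s ] (S s ≡ true × label G s ≡ slim)
slim-member {G} hoffman (x , x∈S) with label G x in ℓx
... | slim = x , x∈S , ℓx
... | fat with hoffman x x∈S ℓx
... | s , s∈S , ℓs , _ = s , s∈S , ℓs

module Addends (G : HoffmanGraph) (U : VSet G) {k : ℕ} (F : Fin k → VSet G)
               (isSum : IsSum G U k F) where

  part-subgraph : ∀ i → IsHoffmanSubgraph G (F i)
  part-subgraph i = proj₁ (proj₁ isSum i)

  sum-cover : ∀ x → U x ≡ true → ∃[ i ] F i x ≡ true
  sum-cover = proj₁ (proj₂ isSum)

  slim-disjoint : ∀ x i j → label G x ≡ slim → F i x ≡ true → F j x ≡ true → i ≡ j
  slim-disjoint = proj₁ (proj₂ (proj₂ isSum))

  fat-closed : ∀ i x z → F i x ≡ true → label G x ≡ slim →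
               U z ≡ true → label G z ≡ fat → adj G x z ≡ true → F i z ≡ true
  fat-closed = proj₁ (proj₂ (proj₂ (proj₂ isSum)))

  sum-condition : ∀ i j x y → i ≢ j → F i x ≡ true → label G x ≡ slim →
                  F j y ≡ true → label G y ≡ slim → SumCondition G U x y
  sum-condition = proj₂ (proj₂ (proj₂ (proj₂ isSum)))

  nested-parts : ∀ {i j} → Nonempty G (F i) → (∀ x → F i x ≡ true → F j x ≡ true) → i ≡ j
  nested-parts {i} {j} nonempty F⊆F with slim-member {G} {F i} (part-subgraph i) nonempty
  ... | s , s∈Fi , ℓs = slim-disjoint s i j ℓs s∈Fi (F⊆F s s∈Fi)

-- For a slim vertex x of an addend, all fat neighbours of x lie in that
-- addend, so common fat neighbours may be counted in the whole graph.
commonFat-part : ∀ {G k} {F : Fin k → VSet G} (isSum : IsSum G (full G) k F) i x y →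
                 F i x ≡ true → label G x ≡ slim →
                 commonFat G (F i) x y ≡ commonFat G (full G) x y
commonFat-part {G} {F = F} isSum i x y x∈Fi ℓx =
  count-cong _ _ λ z → ∧-absorbˡ (F i z) _ (common-in-part z)
  where
  isFat-true : ∀ {a} → isFat a ≡ true → a ≡ fat
  isFat-true {fat} _ = refl
  common-in-part : ∀ z → isFat (label G z) ∧ adj G x z ∧ adj G y z ≡ true → F i z ≡ true
  common-in-part z e with ∧-true⁻ e
  ... | fz , rest = Addends.fat-closed G (full G) F isSum i x z x∈Fi ℓx refl (isFat-true fz) (proj₁ (∧-true⁻ rest))

commonFat-iso : ∀ {G H} (φ : HoffmanIso G H) x y →
                commonFat G (full G) x y ≡
                commonFat H (full H) (Inverse.to (bij φ) x) (Inverse.to (bij φ) y)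
commonFat-iso {G} {H} φ x y = sym (trans (count-permute _ (bij φ)) (count-cong _ _ pointwise))
  where
  to : Fin (size G) → Fin (size H)
  to = Inverse.to (bij φ)
  pointwise : ∀ z → (true ∧ isFat (label H (to z)) ∧ adj H (to x) (to z) ∧ adj H (to y) (to z))
                  ≡ (true ∧ isFat (label G z) ∧ adj G x z ∧ adj G y z)
  pointwise z rewrite pres-label φ z | pres-adj φ x z | pres-adj φ y z = refl

inverse-iso : ∀ {G H} → HoffmanIso G H → HoffmanIso H G
inverse-iso {G} {H} φ = record
  { bij        = ↔-sym (bij φ)
  ; pres-adj   = λ a b → trans (sym (pres-adj φ (from a) (from b)))
                               (cong₂ (adj H) (to∘from a) (to∘from b))
  ; pres-label = λ a → trans (sym (pres-label φ (from a))) (cong (label H) (to∘from a))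
  }
  where
  from : Fin (size H) → Fin (size G)
  from = Inverse.from (bij φ)
  to∘from : ∀ a → Inverse.to (bij φ) (from a) ≡ a
  to∘from = Inverse.strictlyInverseˡ (bij φ)

module Split (G : HoffmanGraph) (U : VSet G) (Q : Fin (size G) → Bool) where

  V : Set
  V = Fin (size G)

  Anchor : V → V → Set
  Anchor v s = U s ≡ true × label G s ≡ slim × (v ≡ s ⊎ (label G v ≡ fat × adj G v s ≡ true))

  OnSide : Bool → V → Set
  OnSide b v = U v ≡ true × ∃[ s ] (Anchor v s × Q s ≡ b)

  onSide? : ∀ b v → Dec (OnSide b v)
  onSide? b v = (U v Bool.≟ true) ×-dec any? λ s →
    ((U s Bool.≟ true) ×-dec (label G s ≟ᴸ slim) ×-dec
     ((v Fin.≟ s) ⊎-dec ((label G v ≟ᴸ fat) ×-dec (adj G v s Bool.≟ true))))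
    ×-dec (Q s Bool.≟ b)

  side : Bool → VSet G
  side b v = does (onSide? b v)

  side-intro : ∀ {b v} s → U v ≡ true → Anchor v s → Q s ≡ b → side b v ≡ true
  side-intro s v∈U anchor Qs = dec-true (onSide? _ _) (v∈U , s , anchor , Qs)

  anchor-of : IsHoffmanSubgraph G U → ∀ v → U v ≡ true → ∃[ s ] Anchor v s
  anchor-of hoffman v v∈U = by-label (label G v) refl
    where
    by-label : ∀ ℓ → label G v ≡ ℓ → ∃[ s ] Anchor v s
    by-label slim ℓv = v , v∈U , ℓv , inj₁ refl
    by-label fat  ℓv with hoffman v v∈U ℓv
    ... | s , s∈U , ℓs , a = s , s∈U , ℓs , inj₂ (ℓv , a)

  self-side : ∀ {b} s → U s ≡ true → label G s ≡ slim → Q s ≡ b → side b s ≡ true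
  self-side s s∈U ℓs Qs = side-intro s s∈U (s∈U , ℓs , inj₁ refl) Qs

  -- A slim vertex is only anchored at itself, so its side is its Q-value.
  slim-side : ∀ {b x} → side b x ≡ true → label G x ≡ slim → Q x ≡ b
  slim-side {b} {x} e ℓx with witness (onSide? b x) e
  ... | _ , s , (_ , _ , inj₁ refl) , Qs = Qs
  ... | _ , s , (_ , _ , inj₂ (ℓx′ , _)) , _ with trans (sym ℓx) ℓx′
  ... | ()

  fat-side : ∀ {b v} → side b v ≡ true → label G v ≡ fat →
             ∃[ s ] (side b s ≡ true × label G s ≡ slim × adj G v s ≡ true)
  fat-side {b} {v} e ℓv with witness (onSide? b v) e
  ... | _ , s , (s∈U , ℓs , inj₂ (_ , a)) , Qs = s , self-side s s∈U ℓs Qs , ℓs , a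
  ... | _ , s , (_ , ℓs , inj₁ refl) , _ with trans (sym ℓv) ℓs
  ... | ()

  side⊆U : ∀ b v → side b v ≡ true → U v ≡ true
  side⊆U b v e = proj₁ (witness (onSide? b v) e)

  fat-anchor : ∀ {b x z} → side b x ≡ true → label G x ≡ slim →
               label G z ≡ fat → adj G x z ≡ true → Anchor z x
  fat-anchor {b} {x} {z} e ℓx ℓz a = side⊆U b x e , ℓx , inj₂ (ℓz , trans (adj-sym G z x) a)

  Separated : Set
  Separated = ∀ x y → U x ≡ true → label G x ≡ slim → Q x ≡ true →
                      U y ≡ true → label G y ≡ slim → Q y ≡ false →
                      SumCondition G U x y × SumCondition G U y x

  sides : Fin 2 → VSet G
  sides = pair (side true) (side false)

  sides-sum : IsHoffmanSubgraph G U → Separated → IsSum G U 2 sides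
  sides-sum hoffman separated = parts , cover , disjoint , closed , condition
    where
    parts : ∀ t → IsHoffmanSubgraph G (sides t) × (∀ v → sides t v ≡ true → U v ≡ true)
    parts zero    = (λ v e ℓv → fat-side e ℓv) , side⊆U true
    parts (suc _) = (λ v e ℓv → fat-side e ℓv) , side⊆U false
    cover : ∀ v → U v ≡ true → ∃[ t ] sides t v ≡ true
    cover v v∈U with anchor-of hoffman v v∈U
    ... | s , anchor with Q s in Qs
    ... | true  = zero , side-intro s v∈U anchor Qs
    ... | false = suc zero , side-intro s v∈U anchor Qs
    disjoint : ∀ x t t′ → label G x ≡ slim → sides t x ≡ true → sides t′ x ≡ true → t ≡ t′
    disjoint x zero       zero       _  _ _ = refl
    disjoint x (suc zero) (suc zero) _  _ _ = refl
    disjoint x zero       (suc zero) ℓx e e′ with trans (sym (slim-side e ℓx)) (slim-side e′ ℓx)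
    ... | ()
    disjoint x (suc zero) zero       ℓx e e′ with trans (sym (slim-side e ℓx)) (slim-side e′ ℓx)
    ... | ()
    closed : ∀ t x z → sides t x ≡ true → label G x ≡ slim →
             U z ≡ true → label G z ≡ fat → adj G x z ≡ true → sides t z ≡ true
    closed zero       x z e ℓx z∈U ℓz a = side-intro x z∈U (fat-anchor e ℓx ℓz a) (slim-side e ℓx)
    closed (suc zero) x z e ℓx z∈U ℓz a = side-intro x z∈U (fat-anchor e ℓx ℓz a) (slim-side e ℓx)
    condition : ∀ t t′ x y → t ≢ t′ → sides t x ≡ true → label G x ≡ slim →
                sides t′ y ≡ true → label G y ≡ slim → SumCondition G U x y
    condition zero       zero       x y t≢t′ _ _ _ _ = ⊥-elim (t≢t′ refl)
    condition (suc zero) (suc zero) x y t≢t′ _ _ _ _ = ⊥-elim (t≢t′ refl)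
    condition zero (suc zero) x y _ ex ℓx ey ℓy =
      proj₁ (separated x y (side⊆U _ x ex) ℓx (slim-side ex ℓx) (side⊆U _ y ey) ℓy (slim-side ey ℓy))
    condition (suc zero) zero x y _ ex ℓx ey ℓy =
      proj₂ (separated y x (side⊆U _ y ey) ℓy (slim-side ey ℓy) (side⊆U _ x ex) ℓx (slim-side ex ℓx))

  split-decomposes : IsHoffmanSubgraph G U → Separated →
    ∀ x y → U x ≡ true → label G x ≡ slim → Q x ≡ true →
            U y ≡ true → label G y ≡ slim → Q y ≡ false → Decomposable G U
  split-decomposes hoffman separated x y x∈U ℓx Qx y∈U ℓy Qy =
    side true , side false , (x , self-side x x∈U ℓx Qx) , (y , self-side y y∈U ℓy Qy) ,
    sides-sum hoffman separated

module Refinement {G H : HoffmanGraph} (φ : HoffmanIso G H) {k l : ℕ}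
  (Gs : Fin k → VSet G) (Hs : Fin l → VSet H)
  (sumG : IsSum G (full G) k Gs) (sumH : IsSum H (full H) l Hs) where

  private
    module AG = Addends G (full G) Gs sumG
    module AH = Addends H (full H) Hs sumH

  to : Fin (size G) → Fin (size H)
  to = Inverse.to (bij φ)

  condition-pullback : ∀ i j j′ x y → j ≢ j′ →
    Gs i x ≡ true → label G x ≡ slim → Hs j (to x) ≡ true →
    label G y ≡ slim → Hs j′ (to y) ≡ true → SumCondition G (Gs i) x y
  condition-pullback i j j′ x y j≢j′ x∈Gi ℓx x↦j ℓy y↦j′ =
    SumCondition-transfer {G} {H} {Gs i} {full H}
      (trans (commonFat-part {G} {F = Gs} sumG i x y x∈Gi ℓx) (commonFat-iso φ x y))
      (sym (pres-adj φ x y))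
      (AH.sum-condition j j′ (to x) (to y) j≢j′
        x↦j (trans (pres-label φ x) ℓx) y↦j′ (trans (pres-label φ y) ℓy))

  -- Splitting Gs i according to whether the image lies in Hs j is separated:
  -- a slim vertex outside Hs j lies in some other addend Hs j′.
  separated : ∀ i j → Split.Separated G (Gs i) (λ x → Hs j (to x))
  separated i j x y x∈Gi ℓx x↦j y∈Gi ℓy y↛j with AH.sum-cover (to y) refl
  ... | j′ , y↦j′ =
    condition-pullback i j j′ x y j≢j′ x∈Gi ℓx x↦j ℓy y↦j′ ,
    condition-pullback i j′ j y x (λ e → j≢j′ (sym e)) y∈Gi ℓy y↦j′ ℓx x↦j
    where
    j≢j′ : j ≢ j′
    j≢j′ refl with trans (sym y↦j′) y↛j
    ... | ()

  refine : ∀ i → Nonempty G (Gs i) → Indecomposable G (Gs i) →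
           ∃[ j ] (∀ x → Gs i x ≡ true → Hs j (to x) ≡ true)
  refine i nonempty indecomposable with slim-member {G} {Gs i} (AG.part-subgraph i) nonempty
  ... | s₀ , s₀∈Gi , ℓs₀ with AH.sum-cover (to s₀) refl
  ... | j , s₀↦j = j , inside
    where
    open Split G (Gs i) (λ x → Hs j (to x)) using (split-decomposes)

    -- Otherwise splitting along Hs j would decompose Gs i.
    slim-inside : ∀ y → Gs i y ≡ true → label G y ≡ slim → Hs j (to y) ≡ true
    slim-inside y y∈Gi ℓy with Hs j (to y) in y↦j
    ... | true  = refl
    ... | false = ⊥-elim (indecomposable (split-decomposes (AG.part-subgraph i) (separated i j)
                    s₀ y s₀∈Gi ℓs₀ s₀↦j y∈Gi ℓy y↦j))

    -- A fat vertex follows a slim neighbour by clause (iii) of ⊕ Hs.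
    inside : ∀ x → Gs i x ≡ true → Hs j (to x) ≡ true
    inside x x∈Gi = by-label (label G x) refl
      where
      by-label : ∀ ℓ → label G x ≡ ℓ → Hs j (to x) ≡ true
      by-label slim ℓx = slim-inside x x∈Gi ℓx
      by-label fat  ℓx with AG.part-subgraph i x x∈Gi ℓx
      ... | s , s∈Gi , ℓs , a =
        AH.fat-closed j (to s) (to x) (slim-inside s s∈Gi ℓs) (trans (pres-label φ s) ℓs)
          refl (trans (pres-label φ x) ℓx) (trans (pres-adj φ s x) (trans (adj-sym G s x) a))

corollary3p2 : (N M : HoffmanGraph) (φ : HoffmanIso N M) (k l : ℕ)
    (Ns : Fin (suc k) → VSet N) (Ms : Fin (suc l) → VSet M) →
    IsSum N (full N) (suc k) Ns → IsSum M (full M) (suc l) Ms →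
    (∀ i → IsAddend N (Ns i) × Indecomposable N (Ns i)) →
    (∀ j → IsAddend M (Ms j) × Indecomposable M (Ms j)) →
    k ≡ l × Σ (Permutation (suc k) (suc l)) λ σ → (∀ (i : Fin (suc k)) → RestrictsToIso φ (Ns i) (Ms (σ ⟨$⟩ʳ i)))
corollary3p2 N M φ k l Ns Ms sumN sumM addendsN addendsM =
  suc-injective (↔⇒≡ σ) , σ , λ i →
    proj₂ (forward i) ,
    λ y y∈M → from y , subst (λ t → Ns t (from y) ≡ true) (g∘f i) (proj₂ (backward (f i)) y y∈M) ,
              Inverse.strictlyInverseˡ (bij φ) y
  where
  to : Fin (size N) → Fin (size M)
  to = Inverse.to (bij φ)
  from : Fin (size M) → Fin (size N)
  from = Inverse.from (bij φ)
  forward : ∀ i → ∃[ j ] (∀ x → Ns i x ≡ true → Ms j (to x) ≡ true)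
  forward i = Refinement.refine φ Ns Ms sumN sumM i (proj₁ (proj₁ (addendsN i))) (proj₂ (addendsN i))
  backward : ∀ j → ∃[ i ] (∀ y → Ms j y ≡ true → Ns i (from y) ≡ true)
  backward j = Refinement.refine (inverse-iso φ) Ms Ns sumM sumN j (proj₁ (proj₁ (addendsM j))) (proj₂ (addendsM j))
  f : Fin (suc k) → Fin (suc l)
  f i = proj₁ (forward i)
  g : Fin (suc l) → Fin (suc k)
  g j = proj₁ (backward j)
  -- Ns i ⊆ Ns (g (f i)), and nested addends coincide; symmetrically for f ∘ g.
  g∘f : ∀ i → g (f i) ≡ i
  g∘f i = sym (Addends.nested-parts N (full N) Ns sumN (proj₁ (proj₁ (addendsN i))) λ x x∈N →
    subst (λ z → Ns (g (f i)) z ≡ true) (Inverse.strictlyInverseʳ (bij φ) x)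
          (proj₂ (backward (f i)) (to x) (proj₂ (forward i) x x∈N)))
  f∘g : ∀ j → f (g j) ≡ j
  f∘g j = sym (Addends.nested-parts M (full M) Ms sumM (proj₁ (proj₁ (addendsM j))) λ y y∈M →
    subst (λ z → Ms (f (g j)) z ≡ true) (Inverse.strictlyInverseˡ (bij φ) y)
          (proj₂ (forward (g j)) (from y) (proj₂ (backward j) y y∈M)))
  σ : Permutation (suc k) (suc l)
  σ = mk↔ₛ′ f g f∘g g∘f
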